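{- Let $G,H$ be graphs. Suppose that in the first round of the game $\mathrm{EHR}^{\mathrm{MSO}}(G,H,3)$ subsets $X\subseteq V(G)$ and $Y\subseteq V(H)$ are chosen, where $|X|\ge2$, $|V(G)\setminus X|\ge 2$, $|Y|\ge 2$, $|V(H)\setminus Y|\ge2$. If the type of the pair $X,\bar X$ equals the type of the pair $Y,\bar Y$, then Duplicator has a strategy for the remaining two rounds that guarantees a win.
   Context: The game $\mathrm{EHR}^{\mathrm{MSO}}(A,B,k)$ is played by Spoiler and Duplicator on graphs $A,B$ for $k$ rounds. In each round Spoiler picks one of the graphs and either a vertex or a subset of its vertex set; Duplicator responds with a vertex (resp. a subset) of the other graph. At the end, chosen vertices $x_i\in V(A)$, $y_i\in V(B)$ (indexed by the rounds in which vertices were chosen) and chosen sets $X_j\subseteq V(A)$, $Y_j\subseteq V(B)$ (indexed by the rounds in which sets were chosen) are compared; Duplicator wins iff for all vertex rounds $i,j$: $x_i\sim x_j\Leftrightarrow y_i\sim y_j$ and $x_i=x_j\Leftrightarrow y_i=y_j$, and for every vertex round $i$ and set round $j$: $x_i\in X_j\Leftrightarrow y_i\in Y_j$. For a graph $G$ and $X\subseteq V(G)$, write $\bar X=V(G)\setminus X$. A vertex $v\in X$ is $X$-inside-dominating if it is adjacent to all vertices of $X\setminus\{v\}$, $X$-inside-isolated if it is adjacent to no vertex of $X$, and $X$-inside-common otherwise; it is $X$-outside-dominating if adjacent to all vertices of $\bar X$, $X$-outside-isolated if adjacent to no vertex of $\bar X$, and $X$-outside-common otherwise. The type of $v\in X$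 (with respect to $X$) is the pair (inside property, outside property) it satisfies. The type of the pair $X,\bar X$ consists of the set of all types (w.r.t. $X$) of vertices of $X$ together with the set of all types (w.r.t. $\bar X$) of vertices of $\bar X$. -}

module Defs where

open import Data.Nat using (ℕ; zero; suc)
open import Data.Bool using (Bool; true; false)
open import Data.Fin using (Fin)
open import Data.Fin.Subset using (Subset; _∈_; ∁)
open import Data.Product using (_×_; Σ; ∃; _,_)
open import Data.Unit using (⊤)
open import Data.List using (List; _∷_; [])
import Data.List.Membership.Propositional as LM
open import Relation.Binary.PropositionalEquality using (_≡_; _≢_)
open import Relation.Nullary using (¬_)
open import Function.Bundles using (_⇔_)

record Graph : Set where
  field
    n      : ℕ
    E      : Fin n → Fin n → Bool
    E-sym  : ∀ u v → E u v ≡ E v u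
    E-irr  : ∀ v → E v v ≡ false

open Graph public

V : Graph → Set
V G = Fin (n G)

VSet : Graph → Set
VSet G = Subset (n G)

Adj : (G : Graph) → V G → V G → Set
Adj G u v = E G u v ≡ true

data InProp : Set where
  in-dom in-iso in-com : InProp

data OutProp : Set where
  out-dom out-iso out-com : OutProp

VType : Set
VType = InProp × OutProp

module _ (G : Graph) (X : VSet G) (v : V G) where
  InsideDominating : Set
  InsideDominating = ∀ u → u ∈ X → u ≢ v → Adj G v u

  InsideIsolated : Set
  InsideIsolated = ∀ u → u ∈ X → ¬ Adj G v u

  OutsideDominating : Set
  OutsideDominating = ∀ u → u ∈ ∁ X → Adj G v u

  OutsideIsolated : Set
  OutsideIsolated = ∀ u → u ∈ ∁ X → ¬ Adj G v u

  HasIn : InProp → Set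
  HasIn in-dom = InsideDominating
  HasIn in-iso = InsideIsolated
  HasIn in-com = ¬ InsideDominating × ¬ InsideIsolated

  HasOut : OutProp → Set
  HasOut out-dom = OutsideDominating
  HasOut out-iso = OutsideIsolated
  HasOut out-com = ¬ OutsideDominating × ¬ OutsideIsolated

  HasType : VType → Set
  HasType (i , o) = v ∈ X × HasIn i × HasOut o

TypeOccurs : (G : Graph) → VSet G → VType → Set
TypeOccurs G X t = ∃ λ v → HasType G X v t

-- The type of the pair X, X̄ in G equals the type of the pair Y, Ȳ in H
-- (equality of the two sets of types, for X and for the complement).
SamePairType : (G H : Graph) → VSet G → VSet H → Set
SamePairType G H X Y =
  (∀ t → TypeOccurs G X t ⇔ TypeOccurs H Y t) ×
  (∀ t → TypeOccurs G (∁ X) t ⇔ TypeOccurs H (∁ Y) t)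

data Move (G H : Graph) : Set where
  vtx : V G → V H → Move G H
  set : VSet G → VSet H → Move G H

Compatible : (G H : Graph) → Move G H → Move G H → Set
Compatible G H (vtx a b) (vtx a' b') =
  (Adj G a a' ⇔ Adj H b b') × (a ≡ a' ⇔ b ≡ b')
Compatible G H (vtx a b) (set X Y) = a ∈ X ⇔ b ∈ Y
Compatible G H (set X Y) (vtx a b) = a ∈ X ⇔ b ∈ Y
Compatible G H (set X Y) (set X' Y') = ⊤

Winning : (G H : Graph) → List (Move G H) → Set
Winning G H ms = ∀ m m' → m LM.∈ ms → m' LM.∈ ms → Compatible G H m m'

DupWins : (G H : Graph) → ℕ → List (Move G H) → Set
DupWins G H zero ms = Winning G H ms
DupWins G H (suc k) ms =
  (∀ (a : V G) → ∃ λ (b : V H) → DupWins G H k (vtx a b ∷ ms)) ×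
  (∀ (b : V H) → ∃ λ (a : V G) → DupWins G H k (vtx a b ∷ ms)) ×
  (∀ (X : VSet G) → ∃ λ (Y : VSet H) → DupWins G H k (set X Y ∷ ms)) ×
  (∀ (Y : VSet H) → ∃ λ (X : VSet G) → DupWins G H k (set X Y ∷ ms))

module Submission where

-- Duplicator answers a vertex a of G by a vertex b of H on the same side (Y or Ȳ) with the
-- same type as a; equality of the pair types provides one. The type of a records which
-- adjacency values (adjacent / non-adjacent) a realizes on the rest of its side and on the
-- other side, and since each side has at least two elements, vertices of equal type realize
-- the same values. Hence every third vertex a' has an answer b' matching its side, its
-- adjacency to a and its equality with a.
--
-- Duplicator answers a set X' by a set Y' occupying the same cells among X ∩ X', X ∖ X',
-- X̄ ∩ X', X̄ ∖ X': on each side of Y, which has two elements, every nonempty set of membership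
-- values for Y' is realizable. A third vertex is then answered in the corresponding cell, and
-- a third set is always easy to answer. Spoiler's moves in H are handled by the same argument
-- with the two graphs exchanged.

open import Defs
open import Data.Nat using (ℕ; zero; suc; _≤_; s≤s)
open import Data.Nat.Properties using (≤-trans; <⇒≤)
open import Data.Fin using (Fin; _≟_)
open import Data.Fin.Properties using (any?; all?)
open import Data.Fin.Subset using (Subset; _∈_; ∁; ∣_∣; ⁅_⁆; _⊆_; Nonempty; ⊤; ⊥)
open import Data.Fin.Subset.Properties
  using (_∈?_; nonempty?; Empty-unique; ∣⊥∣≡0; ∣⁅x⁆∣≡1; x∈⁅x⁆; p⊆q⇒∣p∣≤∣q∣; ∈⊤; ∉⊥;
         x∈p⇒x∉∁p; x∈∁p⇒x∉p; x∉∁p⇒x∈p; x∉p⇒x∈∁p)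
open import Data.Bool using (Bool; true; false)
import Data.Bool as Bool
open import Data.Bool.Properties using (¬-not)
open import Data.Vec using (lookup; tabulate)
open import Data.Vec.Properties using ([]=⇒lookup; lookup⇒[]=; lookup∘tabulate)
open import Data.List using (List; _∷_; []; map)
open import Data.List.Relation.Unary.All as All using (All; _∷_; [])
open import Data.List.Relation.Unary.Any using (here; there)
open import Data.List.Membership.Propositional.Properties using (∈-map⁺)
open import Data.Product using (_×_; _,_; ∃; ∃₂; proj₁; proj₂; map₂; swap)
open import Data.Sum using (_⊎_; inj₁; inj₂) renaming (map to map-⊎)
open import Data.Unit using (tt)
open import Function using (_∘_; _∘₂_)
open import Function.Bundles using (_⇔_; mk⇔; Equivalence)
open import Function.Construct.Symmetry using (⇔-sym)
open import Function.Construct.Composition using (_⇔-∘_)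
open import Relation.Nullary using (¬_; Dec; does; yes; no; contradiction)
open import Relation.Nullary.Decidable
  using (_×-dec_; _→-dec_; ¬?; dec-true; dec-false; decidable-stable)
  renaming (map to map-dec)
open import Relation.Unary using (Decidable)
open import Relation.Binary.PropositionalEquality using (_≡_; _≢_; refl; sym; trans; cong; subst)

open Equivalence using (to; from)

private
  variable
    m k : ℕ
    p : Subset m
    q : Subset k

⇔-both : ∀ {A B : Set} → A → B → A ⇔ B
⇔-both a b = mk⇔ (λ _ → b) (λ _ → a)

⇔-neither : ∀ {A B : Set} → ¬ A → ¬ B → A ⇔ B
⇔-neither ¬a ¬b = mk⇔ (λ a → contradiction a ¬a) (λ b → contradiction b ¬b)

1≤∣p∣⇒nonempty : ∀ {m} {p : Subset m} → 1 ≤ ∣ p ∣ → Nonempty p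
1≤∣p∣⇒nonempty {m} {p} 1≤∣p∣ with nonempty? p
... | yes ne = ne
... | no ¬ne = contradiction (subst (1 ≤_) ∣p∣≡0 1≤∣p∣) λ ()
  where
  ∣p∣≡0 : ∣ p ∣ ≡ 0
  ∣p∣≡0 = trans (cong ∣_∣ (Empty-unique ¬ne)) (∣⊥∣≡0 m)

2≤∣p∣⇒another : 2 ≤ ∣ p ∣ → ∀ y → ∃ λ x → x ∈ p × x ≢ y
2≤∣p∣⇒another {p = p} 2≤∣p∣ y with any? (λ x → (x ∈? p) ×-dec ¬? (x ≟ y))
... | yes found = found
... | no none = contradiction (≤-trans 2≤∣p∣ ∣p∣≤1) λ { (s≤s ()) }
  where
  p⊆⁅y⁆ : p ⊆ ⁅ y ⁆
  p⊆⁅y⁆ {x} x∈p with x ≟ y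
  ... | yes refl = x∈⁅x⁆ x
  ... | no x≢y = contradiction (x , x∈p , x≢y) none

  ∣p∣≤1 : ∣ p ∣ ≤ 1
  ∣p∣≤1 = subst (∣ p ∣ ≤_) (∣⁅x⁆∣≡1 y) (p⊆q⇒∣p∣≤∣q∣ p⊆⁅y⁆)

2≤∣p∣⇒distinct-pair : 2 ≤ ∣ p ∣ → ∃₂ λ x y → x ∈ p × y ∈ p × x ≢ y
2≤∣p∣⇒distinct-pair {p = p} 2≤∣p∣ with 1≤∣p∣⇒nonempty {p = p} (<⇒≤ 2≤∣p∣)
... | x , x∈p with 2≤∣p∣⇒another 2≤∣p∣ x
...   | y , y∈p , y≢x = x , y , x∈p , y∈p , y≢x ∘ sym

∈∁⇒lookup≡false : ∀ {x} → x ∈ ∁ p → lookup p x ≡ false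
∈∁⇒lookup≡false {p = p} x∈∁p = ¬-not (x∈∁p⇒x∉p x∈∁p ∘ lookup⇒[]= _ p)

distinct-on-side : 2 ≤ ∣ p ∣ → 2 ≤ ∣ ∁ p ∣ →
                   ∀ β → ∃₂ λ x y → lookup p x ≡ β × lookup p y ≡ β × x ≢ y
distinct-on-side {p = p} 2≤∣p∣ _ true with 2≤∣p∣⇒distinct-pair {p = p} 2≤∣p∣
... | x , y , x∈p , y∈p , x≢y = x , y , []=⇒lookup x∈p , []=⇒lookup y∈p , x≢y
distinct-on-side {p = p} _ 2≤∣∁p∣ false with 2≤∣p∣⇒distinct-pair {p = ∁ p} 2≤∣∁p∣
... | x , y , x∈∁p , y∈∁p , x≢y =
  x , y , ∈∁⇒lookup≡false x∈∁p , ∈∁⇒lookup≡false y∈∁p , x≢y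

module _ {x : Fin m} {y : Fin k} where

  lookup-≡⇒∈-⇔ : lookup p x ≡ lookup q y → (x ∈ p ⇔ y ∈ q)
  lookup-≡⇒∈-⇔ {p = p} {q = q} e =
    mk⇔ (λ x∈p → lookup⇒[]= y q (trans (sym e) ([]=⇒lookup x∈p)))
        (λ y∈q → lookup⇒[]= x p (trans e ([]=⇒lookup y∈q)))

  ∁-⇔ : (x ∈ ∁ p ⇔ y ∈ ∁ q) → (x ∈ p ⇔ y ∈ q)
  ∁-⇔ e = mk⇔ (λ x∈p → x∉∁p⇒x∈p (x∈p⇒x∉∁p x∈p ∘ from e))
              (λ y∈q → x∉∁p⇒x∈p (x∈p⇒x∉∁p y∈q ∘ to e))

agreeing-subset : (x : Fin m) (y : Fin k) (p : Subset m) → ∃ λ q → x ∈ p ⇔ y ∈ q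
agreeing-subset x y p with x ∈? p
... | yes x∈p = ⊤ , ⇔-both x∈p ∈⊤
... | no x∉p = ⊥ , ⇔-neither x∉p ∉⊥

adj? : (G : Graph) → ∀ u v → Dec (Adj G u v)
adj? G u v = E G u v Bool.≟ true

Adj-irrefl : (G : Graph) → ∀ {v} → ¬ Adj G v v
Adj-irrefl G {v} adj with () ← trans (sym (E-irr G v)) adj

Adj-sym : (G : Graph) → ∀ {u v} → Adj G u v → Adj G v u
Adj-sym G {u} {v} = trans (E-sym G v u)

E-≡⇒Adj-⇔ : ∀ {G H : Graph} {a a' b b'} → E G a a' ≡ E H b b' → Adj G a a' ⇔ Adj H b b'
E-≡⇒Adj-⇔ e = mk⇔ (trans (sym e)) (trans e)

module _ (G : Graph) (v : V G) (P : V G → Set) where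

  Dominates : Set
  Dominates = ∀ u → P u → Adj G v u

  Avoids : Set
  Avoids = ∀ u → P u → ¬ Adj G v u

  Realizes : Bool → Set
  Realizes β = ∃ λ u → P u × E G v u ≡ β

module _ (G : Graph) (v : V G) {P : V G → Set} (P? : Decidable P) where

  dominates? : Dec (Dominates G v P)
  dominates? = all? λ u → P? u →-dec adj? G v u

  avoids? : Dec (Avoids G v P)
  avoids? = all? λ u → P? u →-dec ¬? (adj? G v u)

  realizes? : ∀ β → Dec (Realizes G v P β)
  realizes? β = any? λ u → P? u ×-dec (E G v u Bool.≟ β)

  realizes-mixed : ¬ Dominates G v P → ¬ Avoids G v P → ∀ β → Realizes G v P β
  realizes-mixed _ ¬avoids true =
    decidable-stable (realizes? true) λ none → ¬avoids λ u pu adj → none (u , pu , adj)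
  realizes-mixed ¬dominates _ false =
    decidable-stable (realizes? false) λ none → ¬dominates λ u pu → ¬-not λ e → none (u , pu , e)

module _ {G H : Graph} {v : V G} {w : V H} {P : V G → Set} {Q : V H → Set} {β : Bool} where

  transfer-dominating : Dominates G v P → Dominates H w Q → ∃ Q →
                        Realizes G v P β → Realizes H w Q β
  transfer-dominating dG dH (u , qu) (u' , pu' , refl) =
    u , qu , trans (dH u qu) (sym (dG u' pu'))

  transfer-avoiding : Avoids G v P → Avoids H w Q → ∃ Q →
                      Realizes G v P β → Realizes H w Q β
  transfer-avoiding aG aH (u , qu) (u' , pu' , refl) =
    u , qu , trans (¬-not (aH u qu)) (sym (¬-not (aG u' pu')))

Inside : (G : Graph) → VSet G → V G → V G → Set
Inside G X v u = u ∈ X × u ≢ v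

inside? : (G : Graph) (X : VSet G) (v : V G) → Decidable (Inside G X v)
inside? G X v u = (u ∈? X) ×-dec ¬? (u ≟ v)

module _ {G : Graph} {X : VSet G} {v : V G} where

  insideDominating⇔ : InsideDominating G X v ⇔ Dominates G v (Inside G X v)
  insideDominating⇔ = mk⇔ (λ d u (u∈X , u≢v) → d u u∈X u≢v) (λ d u u∈X u≢v → d u (u∈X , u≢v))

  insideIsolated⇔ : InsideIsolated G X v ⇔ Avoids G v (Inside G X v)
  insideIsolated⇔ = mk⇔ (λ i u (u∈X , _) → i u u∈X) avoids⇒isolated
    where
    avoids⇒isolated : Avoids G v (Inside G X v) → InsideIsolated G X v
    avoids⇒isolated a u u∈X adj with u ≟ v
    ... | yes refl = Adj-irrefl G adj
    ... | no u≢v = a u (u∈X , u≢v) adj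

  inProp : ∃ (HasIn G X v)
  inProp with map-dec (⇔-sym insideDominating⇔) (dominates? G v (inside? G X v))
            | map-dec (⇔-sym insideIsolated⇔) (avoids? G v (inside? G X v))
  ... | yes d | _ = in-dom , d
  ... | no ¬d | yes i = in-iso , i
  ... | no ¬d | no ¬i = in-com , ¬d , ¬i

  outProp : ∃ (HasOut G X v)
  outProp with dominates? G v (_∈? ∁ X) | avoids? G v (_∈? ∁ X)
  ... | yes d | _ = out-dom , d
  ... | no ¬d | yes i = out-iso , i
  ... | no ¬d | no ¬i = out-com , ¬d , ¬i

  typeOf : v ∈ X → ∃ (HasType G X v)
  typeOf v∈X = (proj₁ inProp , proj₁ outProp) , v∈X , proj₂ inProp , proj₂ outProp

module _ {G H : Graph} {X : VSet G} {Y : VSet H} {v : V G} {w : V H} {β : Bool} where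

  inside-transfer : ∀ i → HasIn G X v i → HasIn H Y w i → ∃ (Inside H Y w) →
                    Realizes G v (Inside G X v) β → Realizes H w (Inside H Y w) β
  inside-transfer in-dom dG dH =
    transfer-dominating {G} {H} (to (insideDominating⇔ {G}) dG) (to (insideDominating⇔ {H}) dH)
  inside-transfer in-iso iG iH =
    transfer-avoiding {G} {H} (to (insideIsolated⇔ {G}) iG) (to (insideIsolated⇔ {H}) iH)
  inside-transfer in-com _ (¬d , ¬i) _ _ =
    realizes-mixed H w (inside? H Y w)
      (¬d ∘ from (insideDominating⇔ {H})) (¬i ∘ from (insideIsolated⇔ {H})) β

  outside-transfer : ∀ o → HasOut G X v o → HasOut H Y w o → Nonempty (∁ Y) →
                     Realizes G v (_∈ ∁ X) β → Realizes H w (_∈ ∁ Y) β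
  outside-transfer out-dom = transfer-dominating {G} {H}
  outside-transfer out-iso = transfer-avoiding {G} {H}
  outside-transfer out-com _ (¬d , ¬i) _ _ = realizes-mixed H w (_∈? ∁ Y) ¬d ¬i β

module _ {G H : Graph} where

  mirror : Move G H → Move H G
  mirror (vtx a b) = vtx b a
  mirror (set X Y) = set Y X

  Compatible-refl : ∀ m → Compatible G H m m
  Compatible-refl (vtx a b) = ⇔-neither (Adj-irrefl G) (Adj-irrefl H) , ⇔-both refl refl
  Compatible-refl (set X Y) = tt

  Compatible-sym : ∀ {m m'} → Compatible G H m m' → Compatible G H m' m
  Compatible-sym {vtx _ _} {vtx _ _} (adj , eq) =
    mk⇔ (Adj-sym H ∘ to adj ∘ Adj-sym G) (Adj-sym G ∘ from adj ∘ Adj-sym H) ,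
    mk⇔ (sym ∘ to eq ∘ sym) (sym ∘ from eq ∘ sym)
  Compatible-sym {vtx _ _} {set _ _} agree = agree
  Compatible-sym {set _ _} {vtx _ _} agree = agree
  Compatible-sym {set _ _} {set _ _} tt = tt

  Compatible-mirror : ∀ m m' → Compatible H G (mirror m) (mirror m') → Compatible G H m m'
  Compatible-mirror (vtx _ _) (vtx _ _) (adj , eq) = ⇔-sym adj , ⇔-sym eq
  Compatible-mirror (vtx _ _) (set _ _) agree = ⇔-sym agree
  Compatible-mirror (set _ _) (vtx _ _) agree = ⇔-sym agree
  Compatible-mirror (set _ _) (set _ _) tt = tt

  Winning-[] : Winning G H []
  Winning-[] _ _ ()

  Winning-∷ : ∀ {m ms} → All (Compatible G H m) ms → Winning G H ms → Winning G H (m ∷ ms)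
  Winning-∷ {m} _ _ _ _ (here refl) (here refl) = Compatible-refl m
  Winning-∷ all _ _ _ (here refl) (there m'∈ms) = All.lookup all m'∈ms
  Winning-∷ all _ _ _ (there m∈ms) (here refl) = Compatible-sym (All.lookup all m∈ms)
  Winning-∷ _ win _ _ (there m∈ms) (there m'∈ms) = win _ _ m∈ms m'∈ms

  Winning-mirror : ∀ ms → Winning H G (map mirror ms) → Winning G H ms
  Winning-mirror ms win m m' m∈ms m'∈ms =
    Compatible-mirror m m' (win _ _ (∈-map⁺ mirror m∈ms) (∈-map⁺ mirror m'∈ms))

  DupWins-mirror : ∀ k ms → DupWins H G k (map mirror ms) → DupWins G H k ms
  DupWins-mirror zero ms = Winning-mirror ms
  DupWins-mirror (suc k) ms (back , forth , setBack , setForth) =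
    (λ a → map₂ (λ {b} → DupWins-mirror k (vtx a b ∷ ms)) (forth a)) ,
    (λ b → map₂ (λ {a} → DupWins-mirror k (vtx a b ∷ ms)) (back b)) ,
    (λ X → map₂ (λ {Y} → DupWins-mirror k (set X Y ∷ ms)) (setForth X)) ,
    (λ Y → map₂ (λ {X} → DupWins-mirror k (set X Y ∷ ms)) (setBack Y))

Forth : (G H : Graph) → ℕ → List (Move G H) → Set
Forth G H k ms = (∀ a → ∃ λ b → DupWins G H k (vtx a b ∷ ms)) ×
                 (∀ X → ∃ λ Y → DupWins G H k (set X Y ∷ ms))

dupWins-back-and-forth : ∀ {G H k ms} → Forth G H k ms → Forth H G k (map mirror ms) →
                         DupWins G H (suc k) ms
dupWins-back-and-forth {k = k} {ms} (forth , setForth) (back , setBack) =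
  forth ,
  (λ b → map₂ (λ {a} → DupWins-mirror k (vtx a b ∷ ms)) (back b)) ,
  setForth ,
  (λ Y → map₂ (λ {X} → DupWins-mirror k (set X Y ∷ ms)) (setBack Y))

equal-types-extend : ∀ {G H : Graph} {A : VSet G} {B : VSet H} {a b i o} →
  HasType G A a (i , o) → HasType H B b (i , o) →
  (∀ w → ∃ λ u → u ∈ B × u ≢ w) → Nonempty (∁ B) →
  ∀ a' → ∃ λ b' → Compatible G H (vtx a b) (vtx a' b') × (a' ∈ A ⇔ b' ∈ B)
equal-types-extend {G} {H} {A} {B} {a} {b} {i} {o}
                   (a∈A , ia , oa) (b∈B , ib , ob) anotherInB ∁B≢∅ a'
  with a' ≟ a | a' ∈? A
... | yes refl | _ = b , Compatible-refl {G} {H} (vtx a b) , ⇔-both a∈A b∈B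
... | no a'≢a | yes a'∈A
  with inside-transfer i ia ib (anotherInB b) (a' , (a'∈A , a'≢a) , refl)
...   | b' , (b'∈B , b'≢b) , e =
  b' , (E-≡⇒Adj-⇔ {G} {H} (sym e) , ⇔-neither (a'≢a ∘ sym) (b'≢b ∘ sym)) , ⇔-both a'∈A b'∈B
equal-types-extend {G} {H} {A} {B} {a} {b} {i} {o}
                   (a∈A , ia , oa) (b∈B , ib , ob) anotherInB ∁B≢∅ a' | no a'≢a | no a'∉A
  with outside-transfer o oa ob ∁B≢∅ (a' , x∉p⇒x∈∁p a'∉A , refl)
...   | b' , b'∈∁B , e =
  b' , (E-≡⇒Adj-⇔ {G} {H} (sym e) , ⇔-neither (a'≢a ∘ sym) λ { refl → x∈∁p⇒x∉p b'∈∁B b∈B }) ,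
  ⇔-neither a'∉A (x∈∁p⇒x∉p b'∈∁B)

module _ {G H : Graph} {X : VSet G} {Y : VSet H} where

  forth-after-vertex : ∀ {a b} → (a ∈ X ⇔ b ∈ Y) →
    (∀ a' → ∃ λ b' → Compatible G H (vtx a b) (vtx a' b') × (a' ∈ X ⇔ b' ∈ Y)) →
    Forth G H 0 (vtx a b ∷ set X Y ∷ [])
  forth-after-vertex {a} {b} a∈X⇔b∈Y extension =
    (λ a' → map₂ (λ (compatible , agree) → winning (Compatible-sym {G} {H} compatible ∷ agree ∷ []))
                 (extension a')) ,
    (λ X'' → map₂ (λ agree → winning (agree ∷ tt ∷ [])) (agreeing-subset a b X''))
    where
    winning : ∀ {m} → All (Compatible G H m) (vtx a b ∷ set X Y ∷ []) →
              Winning G H (m ∷ vtx a b ∷ set X Y ∷ [])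
    winning all = Winning-∷ all (Winning-∷ (a∈X⇔b∈Y ∷ []) (Winning-∷ [] Winning-[]))

SameType : (G H : Graph) → VSet G → VSet H → V G → V H → Set
SameType G H X Y a b =
  ∃ λ t → (HasType G X a t × HasType H Y b t) ⊎ (HasType G (∁ X) a t × HasType H (∁ Y) b t)

SameType-mirror : ∀ {G H X Y a b} → SameType G H X Y a b → SameType H G Y X b a
SameType-mirror = map₂ (map-⊎ swap swap)

forth-after-sameType : ∀ {G H X Y a b} → 2 ≤ ∣ Y ∣ → 2 ≤ ∣ ∁ Y ∣ → SameType G H X Y a b →
                       Forth G H 0 (vtx a b ∷ set X Y ∷ [])
forth-after-sameType 2≤∣Y∣ 2≤∣∁Y∣ (_ , inj₁ (ta , tb)) =
  forth-after-vertex (⇔-both (proj₁ ta) (proj₁ tb))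
    (equal-types-extend ta tb (2≤∣p∣⇒another 2≤∣Y∣) (1≤∣p∣⇒nonempty (<⇒≤ 2≤∣∁Y∣)))
forth-after-sameType {Y = Y} 2≤∣Y∣ 2≤∣∁Y∣ (_ , inj₂ (ta , tb)) =
  forth-after-vertex (∁-⇔ (⇔-both (proj₁ ta) (proj₁ tb)))
    (map₂ (map₂ ∁-⇔) ∘ equal-types-extend ta tb (2≤∣p∣⇒another 2≤∣∁Y∣) ∁∁Y≢∅)
  where
  ∁∁Y≢∅ : Nonempty (∁ (∁ Y))
  ∁∁Y≢∅ = map₂ (x∉p⇒x∈∁p ∘ x∈p⇒x∉∁p) (1≤∣p∣⇒nonempty (<⇒≤ 2≤∣Y∣))

-- For p = X and q = X', the four pairs (β , γ) index the cells X ∩ X', X ∖ X', X̄ ∩ X', X̄ ∖ X'.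
Occupied : Subset m → Subset m → Bool → Bool → Set
Occupied p q β γ = ∃ λ x → lookup p x ≡ β × lookup q x ≡ γ

occupied? : (p q : Subset m) → ∀ β γ → Dec (Occupied p q β γ)
occupied? p q β γ = any? λ x → (lookup p x Bool.≟ β) ×-dec (lookup q x Bool.≟ γ)

SameCells : (G H : Graph) → VSet G → VSet H → VSet G → VSet H → Set
SameCells G H X Y X' Y' = ∀ β γ → Occupied X X' β γ ⇔ Occupied Y Y' β γ

forth-after-sameCells : ∀ {G H X Y X' Y'} → SameCells G H X Y X' Y' →
                        Forth G H 0 (set X' Y' ∷ set X Y ∷ [])
forth-after-sameCells {G} {H} {X} {Y} {X'} {Y'} sameCells =
  (λ a → map₂ (λ (eY , eY') → winning (lookup-≡⇒∈-⇔ (sym eY') ∷ lookup-≡⇒∈-⇔ (sym eY) ∷ []))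
              (to (sameCells (lookup X a) (lookup X' a)) (a , refl , refl))) ,
  (λ _ → Y , winning (tt ∷ tt ∷ []))
  where
  winning : ∀ {m} → All (Compatible G H m) (set X' Y' ∷ set X Y ∷ []) →
            Winning G H (m ∷ set X' Y' ∷ set X Y ∷ [])
  winning all = Winning-∷ all (Winning-∷ (tt ∷ []) (Winning-∷ [] Winning-[]))

colouring-using-exactly : ∀ {S : Fin m → Set} → (∃₂ λ y₁ y₂ → S y₁ × S y₂ × y₁ ≢ y₂) →
  ∀ {R : Bool → Set} → (∀ γ → Dec (R γ)) → ∃ R →
  ∃ λ (h : Fin m → Bool) → ∀ γ → (∃ λ y → S y × h y ≡ γ) ⇔ R γ
colouring-using-exactly (y₁ , y₂ , s₁ , s₂ , y₁≢y₂) {R} R? (γ₀ , r₀) with R? true | R? false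
... | yes rt | yes rf = (λ y → does (y ≟ y₁)) , λ where
  true → ⇔-both (y₁ , s₁ , dec-true (y₁ ≟ y₁) refl) rt
  false → ⇔-both (y₂ , s₂ , dec-false (y₂ ≟ y₁) (y₁≢y₂ ∘ sym)) rf
... | yes rt | no ¬rf = (λ _ → true) , λ where
  true → ⇔-both (y₁ , s₁ , refl) rt
  false → ⇔-neither (λ ()) ¬rf
... | no ¬rt | yes rf = (λ _ → false) , λ where
  true → ⇔-neither (λ ()) ¬rt
  false → ⇔-both (y₁ , s₁ , refl) rf
... | no ¬rt | no ¬rf = contradiction r₀ (absent γ₀)
  where
  absent : ∀ γ → ¬ R γ
  absent true = ¬rt
  absent false = ¬rf

occupied-tabulate : ∀ {p : Subset m} (h : Bool → Fin m → Bool) β γ →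
  Occupied p (tabulate λ y → h (lookup p y) y) β γ ⇔ (∃ λ y → lookup p y ≡ β × h β y ≡ γ)
occupied-tabulate h β γ =
  mk⇔ (λ { (y , refl , e) → y , refl , trans (sym (lookup∘tabulate _ y)) e })
      (λ { (y , refl , e) → y , refl , trans (lookup∘tabulate _ y) e })

sameCells-response : ∀ {G H X Y} → 2 ≤ ∣ X ∣ → 2 ≤ ∣ ∁ X ∣ → 2 ≤ ∣ Y ∣ → 2 ≤ ∣ ∁ Y ∣ →
                     ∀ X' → ∃ λ Y' → SameCells G H X Y X' Y'
sameCells-response {G} {H} {X} {Y} 2≤∣X∣ 2≤∣∁X∣ 2≤∣Y∣ 2≤∣∁Y∣ X' =
  tabulate (λ y → colour (lookup Y y) y) ,
  λ β γ → ⇔-sym (proj₂ (colouring β) γ ⇔-∘ occupied-tabulate {p = Y} colour β γ)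
  where
  occupied-somewhere : ∀ β → ∃ (Occupied X X' β)
  occupied-somewhere β with distinct-on-side {p = X} 2≤∣X∣ 2≤∣∁X∣ β
  ... | x , _ , x-on-side , _ = lookup X' x , x , x-on-side , refl

  colouring : ∀ β → ∃ λ h → ∀ γ → (∃ λ y → lookup Y y ≡ β × h y ≡ γ) ⇔ Occupied X X' β γ
  colouring β = colouring-using-exactly (distinct-on-side {p = Y} 2≤∣Y∣ 2≤∣∁Y∣ β)
                                        (occupied? X X' β) (occupied-somewhere β)

  colour : Bool → V H → Bool
  colour β = proj₁ (colouring β)

sameType-response : ∀ {G H X Y} → SamePairType G H X Y → ∀ a → ∃ (SameType G H X Y a)
sameType-response {G} {X = X} (typesOfX , typesOf∁X) a with a ∈? X
... | yes a∈X with typeOf {G} a∈X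
...   | t , ta = map₂ (λ tb → t , inj₁ (ta , tb)) (to (typesOfX t) (a , ta))
sameType-response {G} (typesOfX , typesOf∁X) a | no a∉X with typeOf {G} (x∉p⇒x∈∁p a∉X)
...   | t , ta = map₂ (λ tb → t , inj₂ (ta , tb)) (to (typesOf∁X t) (a , ta))

SamePairType-mirror : ∀ {G H X Y} → SamePairType G H X Y → SamePairType H G Y X
SamePairType-mirror (typesOfX , typesOf∁X) = ⇔-sym ∘ typesOfX , ⇔-sym ∘ typesOf∁X

forth-second-round : ∀ {G H X Y} → 2 ≤ ∣ X ∣ → 2 ≤ ∣ ∁ X ∣ → 2 ≤ ∣ Y ∣ → 2 ≤ ∣ ∁ Y ∣ →
                     SamePairType G H X Y → Forth G H 1 (set X Y ∷ [])
forth-second-round {G} {H} {X} {Y} 2≤∣X∣ 2≤∣∁X∣ 2≤∣Y∣ 2≤∣∁Y∣ samePairType =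
  (λ a → map₂ (λ sameType →
                 dupWins-back-and-forth (forth-after-sameType 2≤∣Y∣ 2≤∣∁Y∣ sameType)
                   (forth-after-sameType 2≤∣X∣ 2≤∣∁X∣ (SameType-mirror sameType)))
              (sameType-response samePairType a)) ,
  (λ X' → map₂ (λ sameCells →
                  dupWins-back-and-forth (forth-after-sameCells sameCells)
                    (forth-after-sameCells (⇔-sym ∘₂ sameCells)))
               (sameCells-response {G} {H} {X} {Y} 2≤∣X∣ 2≤∣∁X∣ 2≤∣Y∣ 2≤∣∁Y∣ X'))

lemma7 : (G H : Graph) (X : VSet G) (Y : VSet H) →
    2 ≤ ∣ X ∣ → 2 ≤ ∣ ∁ X ∣ → 2 ≤ ∣ Y ∣ → 2 ≤ ∣ ∁ Y ∣ →
    SamePairType G H X Y →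
    DupWins G H 2 (set X Y ∷ [])
lemma7 G H X Y 2≤∣X∣ 2≤∣∁X∣ 2≤∣Y∣ 2≤∣∁Y∣ samePairType =
  dupWins-back-and-forth
    (forth-second-round 2≤∣X∣ 2≤∣∁X∣ 2≤∣Y∣ 2≤∣∁Y∣ samePairType)
    (forth-second-round 2≤∣Y∣ 2≤∣∁Y∣ 2≤∣X∣ 2≤∣∁X∣ (SamePairType-mirror samePairType))
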